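{- Let $G$ be a finite simple connected graph such that $G$ is isomorphic to neither $K_3$ nor $K_5$, and $\Delta(G)\le 5$. Suppose $G$ contains none of the following configurations: $C_1$: a vertex of degree $2$ whose two neighbours are not adjacent; $C_2$: a cut-edge $uv$ such that $d(u)$ and $d(v)$ are both even; $C_3$: an edge $uv$ with $d(u)=d(v)=4$ such that $u$ and $v$ have exactly $2$ common neighbours; $C_4$: an edge $uv$ with $d(u)=d(v)=4$ such that the three neighbours of $u$ other than $v$ can be labelled $t_1,t_2,t_3$ and the three neighbours of $v$ other than $u$ can be labelled $w_1,w_2,w_3$ so that $t_1t_2\notin E(G)$, $w_1w_2\notin E(G)$ and $t_3\neq w_3$; $C_5$: a triangle $uvw$ in $G$ with $d(u)=4$ and $d(v),d(w)\in\{2,4\}$. Then $G_E$ is a forest.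
   Context: All degrees $d(\cdot)$ are taken in $G$. $G_E$ denotes the subgraph of $G$ induced by the vertices of even degree in $G$. A cut-edge is an edge whose removal increases the number of connected components. -}

module Defs where

open import Data.Nat using (ℕ; zero; suc; _≤_; _%_)
open import Data.Bool using (Bool; true; false; not; T; _∧_)
open import Data.Fin using (Fin; zero; suc; inject₁; fromℕ)
open import Data.Fin.Properties using (_≟_)
open import Data.List using (List; length; filterᵇ; allFin)
open import Data.Product using (Σ; ∃; ∃-syntax; _×_; _,_)
open import Data.Sum using (_⊎_)
open import Relation.Nullary using (¬_; does)
open import Relation.Binary.PropositionalEquality using (_≡_; _≢_)
open import Relation.Binary.Construct.Closure.ReflexiveTransitive using (Star)
open import Function.Definitions using (Injective; Bijective)

record Graph (n : ℕ) : Set where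
  field
    E        : Fin n → Fin n → Bool
    E-sym    : ∀ u v → E u v ≡ E v u
    E-irrefl : ∀ u → E u u ≡ false

module _ {n : ℕ} (G : Graph n) where
  open Graph G

  Adj : Fin n → Fin n → Set
  Adj u v = T (E u v)

  deg : Fin n → ℕ
  deg v = length (filterᵇ (E v) (allFin n))

  IsEven : Fin n → Set
  IsEven v = deg v % 2 ≡ 0

  MaxDegAtMost : ℕ → Set
  MaxDegAtMost k = ∀ v → deg v ≤ k

  Connected : Set
  Connected = ∀ u v → Star Adj u v

  AdjMinus : Fin n → Fin n → Fin n → Fin n → Set
  AdjMinus u v x y = Adj x y × ¬ ((x ≡ u × y ≡ v) ⊎ (x ≡ v × y ≡ u))

  -- uv is a cut-edge: an edge whose removal disconnects u from v
  -- (equivalently, increases the number of connected components)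
  CutEdge : Fin n → Fin n → Set
  CutEdge u v = Adj u v × ¬ Star (AdjMinus u v) u v

  commonNbrs : Fin n → Fin n → ℕ
  commonNbrs u v = length (filterᵇ (λ w → E u w ∧ E v w) (allFin n))

  C1 : Set
  C1 = ∃[ v ] ∃[ a ] ∃[ b ]
         (deg v ≡ 2 × a ≢ b × Adj v a × Adj v b × ¬ Adj a b)

  C2 : Set
  C2 = ∃[ u ] ∃[ v ] (CutEdge u v × IsEven u × IsEven v)

  C3 : Set
  C3 = ∃[ u ] ∃[ v ] (Adj u v × deg u ≡ 4 × deg v ≡ 4 × commonNbrs u v ≡ 2)

  -- t1,t2,t3 are three distinct neighbours of u other than v (hence, as
  -- d(u)=4, exactly those), and similarly w1,w2,w3 for v.
  C4 : Set
  C4 = ∃[ u ] ∃[ v ] (Adj u v × deg u ≡ 4 × deg v ≡ 4 ×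
         ∃[ t₁ ] ∃[ t₂ ] ∃[ t₃ ] ∃[ w₁ ] ∃[ w₂ ] ∃[ w₃ ]
           ((Adj u t₁ × Adj u t₂ × Adj u t₃) ×
            (t₁ ≢ v × t₂ ≢ v × t₃ ≢ v) ×
            (t₁ ≢ t₂ × t₁ ≢ t₃ × t₂ ≢ t₃) ×
            (Adj v w₁ × Adj v w₂ × Adj v w₃) ×
            (w₁ ≢ u × w₂ ≢ u × w₃ ≢ u) ×
            (w₁ ≢ w₂ × w₁ ≢ w₃ × w₂ ≢ w₃) ×
            ¬ Adj t₁ t₂ × ¬ Adj w₁ w₂ × t₃ ≢ w₃))

  C5 : Set
  C5 = ∃[ u ] ∃[ v ] ∃[ w ] (Adj u v × Adj v w × Adj u w ×
         deg u ≡ 4 × (deg v ≡ 2 ⊎ deg v ≡ 4) × (deg w ≡ 2 ⊎ deg w ≡ 4))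

  -- a cycle in the induced subgraph of G on the vertices satisfying P:
  -- distinct vertices c 0, ..., c m (m ≥ 2, i.e. length ≥ 3), all in P,
  -- consecutive ones adjacent and c m adjacent to c 0.
  record CycleIn (P : Fin n → Set) : Set where
    field
      m      : ℕ
      m≥2    : 2 ≤ m
      c      : Fin (suc m) → Fin n
      c-inj  : Injective _≡_ _≡_ c
      c-in   : ∀ i → P (c i)
      c-step : ∀ (i : Fin m) → Adj (c (inject₁ i)) (c (suc i))
      c-close : Adj (c (fromℕ m)) (c zero)

  -- G_E (induced subgraph on even-degree vertices) is a forest
  EvenSubgraphIsForest : Set
  EvenSubgraphIsForest = ¬ CycleIn IsEven

K : (m : ℕ) → Graph m
K m = record
  { E = λ u v → not (does (u ≟ v))
  ; E-sym = sym′
  ; E-irrefl = irr }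
  where
    open import Relation.Nullary using (yes; no)
    open import Relation.Binary.PropositionalEquality using (refl; sym)
    open import Data.Empty using (⊥-elim)
    sym′ : ∀ u v → not (does (u ≟ v)) ≡ not (does (v ≟ u))
    sym′ u v with u ≟ v | v ≟ u
    ... | yes _ | yes _ = refl
    ... | no _  | no _  = refl
    ... | yes p | no q  = ⊥-elim (q (sym p))
    ... | no p  | yes q = ⊥-elim (p (sym q))
    irr : ∀ u → not (does (u ≟ u)) ≡ false
    irr u with u ≟ u
    ... | yes _ = refl
    ... | no q  = ⊥-elim (q refl)

_≅_ : {n m : ℕ} → Graph n → Graph m → Set
_≅_ {n} {m} G H = Σ (Fin n → Fin m) λ f →
  Bijective _≡_ _≡_ f × (∀ u v → Graph.E G u v ≡ Graph.E H (f u) (f v))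

module Submission where

-- Let G satisfy the hypotheses and suppose G_E contains a cycle.  Every vertex of
-- the cycle has even degree, hence degree 2 or 4 (it has a neighbour and Δ ≤ 5).
--
--  * A middle vertex q of a path p q s of even-degree vertices has degree 4: if
--    d(q) = 2 then ¬C1 forces p ~ s, and in the triangle p q s the other two
--    vertices have degree 2 by ¬C5, so by connectivity G is the triangle, i.e. K3.
--    Hence every vertex of the cycle has degree 4.
--  * A triangle of degree-4 vertices is configuration C5; this kills cycles of
--    length 3, and for longer cycles gives a path x u v y of degree-4 vertices
--    with x ≁ v and u ≁ y.
--  * Such a path is impossible.  Using ¬C3, x lies in a non-adjacent pair of
--    neighbours of u other than v ("a split of u away from v", with a remaining
--    "third" neighbour), and likewise y for v.  By ¬C4 any two such splits have
--    the same third t, and re-splitting shows t sees both members of each pair.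
--    Then either u, v have exactly two common neighbours (C3) or t has six
--    neighbours, contradicting Δ ≤ 5.

open import Defs
open import Data.Nat using (ℕ; zero; suc; _+_; _≤_; _<_; _%_; z≤n; s≤s)
open import Data.Nat.Properties using (≤-antisym; <⇒≱; n<1+n)
open import Data.Bool using (Bool; T; not; _∧_)
open import Data.Bool.Properties using (T-∧; T-≡)
open import Data.Fin using (Fin; zero; suc; inject₁; fromℕ)
open import Data.Fin.Patterns using (0F; 1F; 2F; 3F; 4F)
open import Data.Fin.Properties using (_≟_)
open import Data.List using (List; []; _∷_; length; filterᵇ; allFin)
open import Data.List.Membership.Propositional using (_∈_; _∉_; find; lose)
open import Data.List.Membership.Propositional.Properties using (∈-filter⁺; ∈-filter⁻; ∈-allFin)
open import Data.List.Relation.Unary.Any using (here; there; any?)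
open import Data.List.Relation.Unary.All as All using (All; []; _∷_)
open import Data.List.Relation.Unary.All.Properties using (¬Any⇒All¬)
open import Data.List.Relation.Unary.AllPairs using ([]; _∷_)
open import Data.List.Relation.Unary.Unique.Propositional using (Unique)
open import Data.List.Relation.Unary.Unique.Propositional.Properties using (filter⁺; allFin⁺)
open import Data.List.Relation.Binary.Permutation.Propositional as ↭ using (_↭_; ↭⇒↭ₛ)
open import Data.List.Relation.Binary.Permutation.Propositional.Properties using (All-resp-↭)
import Data.List.Relation.Binary.Permutation.Setoid.Properties as SetoidPerm
open import Data.Product using (∃; ∃₂; _×_; _,_; proj₁; proj₂)
open import Data.Sum using (_⊎_; inj₁; inj₂)
open import Data.Empty using (⊥; ⊥-elim)
open import Function using (_∘_)
open import Function.Bundles using (Equivalence)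
open import Function.Definitions using (Injective)
open import Function.Consequences.Propositional using (strictlySurjective⇒surjective)
open import Relation.Nullary using (¬_; Dec; yes; no; does)
open import Relation.Nullary.Decidable using (T?; ¬?; decidable-stable)
open import Relation.Binary.Definitions using (DecidableEquality)
open import Relation.Binary.PropositionalEquality
  using (_≡_; _≢_; refl; sym; trans; cong; subst; setoid; ≢-sym)
open import Relation.Binary.Construct.Closure.ReflexiveTransitive using (Star; ε; _◅_)

∈-delete : ∀ {A : Set} {x : A} {ys : List A} → x ∈ ys →
  ∃ λ ys′ → length ys ≡ suc (length ys′) × (∀ {z} → z ∈ ys → z ≢ x → z ∈ ys′)
∈-delete {ys = _ ∷ ys} (here refl) =
  ys , refl , λ { (here z≡x) z≢x → ⊥-elim (z≢x z≡x) ; (there z∈ys) _ → z∈ys }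
∈-delete {ys = y ∷ ys} (there x∈ys) =
  let (ys′ , len , keep) = ∈-delete x∈ys in
  y ∷ ys′ , cong suc len , λ { (here z≡y) _ → here z≡y ; (there z∈ys) z≢x → there (keep z∈ys z≢x) }

unique-⊆-length : ∀ {A : Set} {xs ys : List A} →
  Unique xs → (∀ {z} → z ∈ xs → z ∈ ys) → length xs ≤ length ys
unique-⊆-length {xs = []} _ _ = z≤n
unique-⊆-length {xs = x ∷ xs} (x≢xs ∷ uniq) xs⊆ys =
  let (ys′ , len , keep) = ∈-delete (xs⊆ys (here refl)) in
  subst (suc (length xs) ≤_) (sym len)
    (s≤s (unique-⊆-length uniq λ z∈xs →
      keep (xs⊆ys (there z∈xs)) (λ z≡x → All.lookup x≢xs z∈xs (sym z≡x))))

module _ {A : Set} (_≟ᴬ_ : DecidableEquality A) where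
  open import Data.List.Membership.DecPropositional _≟ᴬ_ using (_∈?_)

  unique-escape : ∀ {xs ys : List A} → Unique xs → length ys < length xs → ∃ λ z → z ∈ xs × z ∉ ys
  unique-escape {xs} {ys} uniq ys<xs with any? (λ z → ¬? (z ∈? ys)) xs
  ... | yes escapee = find escapee
  ... | no ¬escapee = ⊥-elim (<⇒≱ ys<xs (unique-⊆-length uniq λ {z} z∈xs →
          decidable-stable (z ∈? ys) (¬escapee ∘ lose z∈xs)))

unique-resp-↭ : ∀ {A : Set} {xs ys : List A} → xs ↭ ys → Unique xs → Unique ys
unique-resp-↭ {A} p = SetoidPerm.Unique-resp-↭ (setoid A) (↭⇒↭ₛ p)

module Selection {n : ℕ} (P : Fin n → Bool) where

  selected : List (Fin n)
  selected = filterᵇ P (allFin n)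

  selected-unique : Unique selected
  selected-unique = filter⁺ (T? ∘ P) (allFin⁺ n)

  ∈-selected⁺ : ∀ {z} → T (P z) → z ∈ selected
  ∈-selected⁺ {z} = ∈-filter⁺ (T? ∘ P) (∈-allFin z)

  ∈-selected⁻ : ∀ {z} → z ∈ selected → T (P z)
  ∈-selected⁻ = proj₂ ∘ ∈-filter⁻ (T? ∘ P) {xs = allFin n}

  count-≥ : ∀ {xs} → Unique xs → All (T ∘ P) xs → length xs ≤ length selected
  count-≥ uniq pass = unique-⊆-length uniq (∈-selected⁺ ∘ All.lookup pass)

  count-≤ : ∀ {xs} → (∀ {z} → T (P z) → z ∈ xs) → length selected ≤ length xs
  count-≤ complete = unique-⊆-length selected-unique (complete ∘ ∈-selected⁻)

open Selection using (selected-unique; ∈-selected⁻; count-≥; count-≤)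

even-1-to-5 : ∀ k → k % 2 ≡ 0 → 1 ≤ k → k ≤ 5 → k ≡ 2 ⊎ k ≡ 4
even-1-to-5 2 _ _ _ = inj₁ refl
even-1-to-5 4 _ _ _ = inj₂ refl
even-1-to-5 0 _ () _
even-1-to-5 1 () _ _
even-1-to-5 3 () _ _
even-1-to-5 5 () _ _
even-1-to-5 (suc (suc (suc (suc (suc (suc _)))))) _ _ (s≤s (s≤s (s≤s (s≤s (s≤s ())))))

module GraphFacts {n : ℕ} (G : Graph n) where
  open Graph G

  private
    V : Set
    V = Fin n
    A : V → V → Set
    A = Adj G
    d : V → ℕ
    d = deg G
    ev : V → Set
    ev = IsEven G

  adj-sym : ∀ {u v} → A u v → A v u
  adj-sym {u} {v} = subst T (E-sym u v)

  adj⇒≢ : ∀ {u v} → A u v → u ≢ v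
  adj⇒≢ {u} uu refl = subst T (E-irrefl u) uu

  adj? : ∀ u v → Dec (A u v)
  adj? u v = T? (E u v)

  Nbrs : V → List V → Set
  Nbrs u xs = Unique xs × All (A u) xs

  reorder : ∀ {u xs ys} → xs ↭ ys → Nbrs u xs → Nbrs u ys
  reorder p (uniq , adj) = unique-resp-↭ p uniq , All-resp-↭ p adj

  too-many-nbrs : ∀ {u xs} → Nbrs u xs → d u < length xs → ⊥
  too-many-nbrs {u} (uniq , adj) d<len = <⇒≱ d<len (count-≥ (E u) uniq adj)

  extend-nbrs : ∀ {u xs} → Nbrs u xs → length xs < d u → ∃ λ z → Nbrs u (z ∷ xs)
  extend-nbrs {u} {xs} (uniq , adj) len<d =
    let (z , z∈N , z∉xs) = unique-escape _≟_ (selected-unique (E u)) len<d in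
    z , (¬Any⇒All¬ xs z∉xs ∷ uniq) , (∈-selected⁻ (E u) z∈N ∷ adj)

  remaining-nbrs : ∀ {u x v} → d u ≡ 4 → A u x → A u v → x ≢ v →
    ∃₂ λ t₁ t₂ → Nbrs u (t₂ ∷ t₁ ∷ x ∷ v ∷ [])
  remaining-nbrs du ux uv x≢v =
    let (t₁ , N₁) = extend-nbrs ((x≢v ∷ []) ∷ [] ∷ [] , ux ∷ uv ∷ [])
                                (subst (2 <_) (sym du) (s≤s (s≤s (s≤s z≤n))))
        (t₂ , N₂) = extend-nbrs N₁ (subst (3 <_) (sym du) (n<1+n 3))
    in t₁ , t₂ , N₂

  degree-2-nbrs : ∀ {a b c w} → d a ≡ 2 → A a b → A a c → b ≢ c → A a w → w ≡ b ⊎ w ≡ c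
  degree-2-nbrs {b = b} {c} {w} da ab ac b≢c aw with w ≟ b | w ≟ c
  ... | yes w≡b | _ = inj₁ w≡b
  ... | no _ | yes w≡c = inj₂ w≡c
  ... | no w≢b | no w≢c = ⊥-elim (too-many-nbrs
          ((w≢b ∷ w≢c ∷ []) ∷ (b≢c ∷ []) ∷ [] ∷ [] , aw ∷ ab ∷ ac ∷ [])
          (subst (_< 3) (sym da) (n<1+n 2)))

  two-common-nbrs : ∀ {u s₁ s₂ q p} → d u ≡ 4 → Nbrs u (s₁ ∷ s₂ ∷ q ∷ p ∷ []) →
    A p s₁ → A p s₂ → ¬ A p q → commonNbrs G u p ≡ 2
  two-common-nbrs {u} {s₁} {s₂} {q} {p} du N@(((s₁≢s₂ ∷ _) ∷ _) , us₁ ∷ us₂ ∷ _) ps₁ ps₂ p≁q =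
    ≤-antisym (count-≤ common only-s) (count-≥ common ((s₁≢s₂ ∷ []) ∷ [] ∷ []) (both us₁ ps₁ ∷ both us₂ ps₂ ∷ []))
    where
    common : V → Bool
    common w = E u w ∧ E p w

    both : ∀ {w} → A u w → A p w → T (common w)
    both uw pw = Equivalence.from T-∧ (uw , pw)

    -- a fifth common neighbour would be a fifth neighbour of u
    only-s : ∀ {z} → T (common z) → z ∈ s₁ ∷ s₂ ∷ []
    only-s {z} uz∧pz with z ≟ s₁ | z ≟ s₂ | Equivalence.to T-∧ uz∧pz
    ... | yes z≡s₁ | _ | _ = here z≡s₁
    ... | no _ | yes z≡s₂ | _ = there (here z≡s₂)
    ... | no z≢s₁ | no z≢s₂ | uz , pz = ⊥-elim (too-many-nbrs
            ((z≢s₁ ∷ z≢s₂ ∷ (λ z≡q → p≁q (subst (A p) z≡q pz)) ∷ ≢-sym (adj⇒≢ pz) ∷ [])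
              ∷ proj₁ N , uz ∷ proj₂ N)
            (subst (_< 5) (sym du) (n<1+n 4)))

  complete⇒≅K : ∀ {m} (f : V → Fin m) (g : Fin m → V) →
    (∀ z → g (f z) ≡ z) → (∀ i → f (g i) ≡ i) → (∀ u v → u ≢ v → A u v) → G ≅ K m
  complete⇒≅K f g gf≗id fg≗id complete =
    f , (f-injective , strictlySurjective⇒surjective (λ i → g i , fg≗id i)) , preserves
    where
    f-injective : Injective _≡_ _≡_ f
    f-injective {u} {v} fu≡fv = trans (sym (gf≗id u)) (trans (cong g fu≡fv) (gf≗id v))

    preserves : ∀ u v → E u v ≡ not (does (f u ≟ f v))
    preserves u v with u ≟ v | f u ≟ f v
    ... | yes refl | yes _ = E-irrefl u
    ... | yes refl | no fu≢fu = ⊥-elim (fu≢fu refl)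
    ... | no u≢v | yes fu≡fv = ⊥-elim (u≢v (f-injective fu≡fv))
    ... | no u≢v | no _ = Equivalence.to T-≡ (complete u v u≢v)

  module _ (conn : Connected G) {p q r : V} (pq : A p q) (qr : A q r) (pr : A p r)
           (dp : d p ≡ 2) (dq : d q ≡ 2) (dr : d r ≡ 2) where

    private
      Corner : V → Set
      Corner z = z ≡ p ⊎ z ≡ q ⊎ z ≡ r

      corner-step : ∀ {a w} → Corner a → A a w → Corner w
      corner-step (inj₁ refl) aw with degree-2-nbrs dp pq pr (adj⇒≢ qr) aw
      ... | inj₁ w≡q = inj₂ (inj₁ w≡q)
      ... | inj₂ w≡r = inj₂ (inj₂ w≡r)
      corner-step (inj₂ (inj₁ refl)) aw with degree-2-nbrs dq (adj-sym pq) qr (adj⇒≢ pr) aw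
      ... | inj₁ w≡p = inj₁ w≡p
      ... | inj₂ w≡r = inj₂ (inj₂ w≡r)
      corner-step (inj₂ (inj₂ refl)) aw with degree-2-nbrs dr (adj-sym pr) (adj-sym qr) (adj⇒≢ pq) aw
      ... | inj₁ w≡p = inj₁ w≡p
      ... | inj₂ w≡q = inj₂ (inj₁ w≡q)

      corner-walk : ∀ {a z} → Corner a → Star A a z → Corner z
      corner-walk c ε = c
      corner-walk c (aw ◅ walk) = corner-walk (corner-step c aw) walk

      every-vertex-corner : ∀ z → Corner z
      every-vertex-corner z = corner-walk (inj₁ refl) (conn p z)

      complete : ∀ u v → u ≢ v → A u v
      complete u v u≢v with every-vertex-corner u | every-vertex-corner v
      ... | inj₁ refl | inj₁ refl = ⊥-elim (u≢v refl)
      ... | inj₁ refl | inj₂ (inj₁ refl) = pq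
      ... | inj₁ refl | inj₂ (inj₂ refl) = pr
      ... | inj₂ (inj₁ refl) | inj₁ refl = adj-sym pq
      ... | inj₂ (inj₁ refl) | inj₂ (inj₁ refl) = ⊥-elim (u≢v refl)
      ... | inj₂ (inj₁ refl) | inj₂ (inj₂ refl) = qr
      ... | inj₂ (inj₂ refl) | inj₁ refl = adj-sym pr
      ... | inj₂ (inj₂ refl) | inj₂ (inj₁ refl) = adj-sym qr
      ... | inj₂ (inj₂ refl) | inj₂ (inj₂ refl) = ⊥-elim (u≢v refl)

      index : V → Fin 3
      index z with z ≟ p | z ≟ q
      ... | yes _ | _ = 0F
      ... | no _ | yes _ = 1F
      ... | no _ | no _ = 2F

      corner : Fin 3 → V
      corner 0F = p
      corner 1F = q
      corner 2F = r

      corner-index : ∀ z → corner (index z) ≡ z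
      corner-index z with z ≟ p | z ≟ q | every-vertex-corner z
      ... | yes z≡p | _ | _ = sym z≡p
      ... | no _ | yes z≡q | _ = sym z≡q
      ... | no z≢p | no _ | inj₁ z≡p = ⊥-elim (z≢p z≡p)
      ... | no _ | no z≢q | inj₂ (inj₁ z≡q) = ⊥-elim (z≢q z≡q)
      ... | no _ | no _ | inj₂ (inj₂ z≡r) = sym z≡r

      index-corner : ∀ i → index (corner i) ≡ i
      index-corner 0F with p ≟ p | p ≟ q
      ... | yes _ | _ = refl
      ... | no p≢p | _ = ⊥-elim (p≢p refl)
      index-corner 1F with q ≟ p | q ≟ q
      ... | yes q≡p | _ = ⊥-elim (adj⇒≢ pq (sym q≡p))
      ... | no _ | yes _ = refl
      ... | no _ | no q≢q = ⊥-elim (q≢q refl)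
      index-corner 2F with r ≟ p | r ≟ q
      ... | yes r≡p | _ = ⊥-elim (adj⇒≢ pr (sym r≡p))
      ... | no _ | yes r≡q = ⊥-elim (adj⇒≢ qr (sym r≡q))
      ... | no _ | no _ = refl

    degree-2-triangle⇒K3 : G ≅ K 3
    degree-2-triangle⇒K3 = complete⇒≅K index corner corner-index index-corner complete

  even-degree : MaxDegAtMost G 5 → ∀ {v w} → ev v → A v w → d v ≡ 2 ⊎ d v ≡ 4
  even-degree Δ≤5 {v} {w} even vw =
    even-1-to-5 (d v) even (count-≥ (E v) ([] ∷ []) (vw ∷ [])) (Δ≤5 v)

  -- The middle vertex of a path p q s of even-degree vertices has degree 4:
  -- degree 2 would give (¬C1, ¬C5) a triangle of degree-2 vertices, i.e. K3.
  middle-degree-4 : Connected G → ¬ (G ≅ K 3) → MaxDegAtMost G 5 → ¬ C1 G → ¬ C5 G →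
    ∀ {p q s} → ev p → ev q → ev s → A p q → A q s → p ≢ s → d q ≡ 4
  middle-degree-4 conn ¬K3 Δ≤5 ¬C1 ¬C5 {p} {q} {s} ep eq es pq qs p≢s with even-degree Δ≤5 eq qs
  ... | inj₂ dq = dq
  ... | inj₁ dq with adj? p s
  ...   | no p≁s = ⊥-elim (¬C1 (q , p , s , dq , p≢s , adj-sym pq , qs , p≁s))
  ...   | yes ps with even-degree Δ≤5 ep pq | even-degree Δ≤5 es (adj-sym qs)
  ...     | inj₂ dp | ds = ⊥-elim (¬C5 (p , q , s , pq , qs , ps , dp , inj₁ dq , ds))
  ...     | dp | inj₂ ds = ⊥-elim (¬C5 (s , q , p , adj-sym qs , adj-sym pq , adj-sym ps , ds , inj₁ dq , dp))
  ...     | inj₁ dp | inj₁ ds = ⊥-elim (¬K3 (degree-2-triangle⇒K3 conn pq qs ps dp dq ds))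

  no-degree-4-triangle : ¬ C5 G → ∀ {a b c} → A a b → A b c → A a c →
    d a ≡ 4 → d b ≡ 4 → d c ≡ 4 → ⊥
  no-degree-4-triangle ¬C5 {a} {b} {c} ab bc ac da db dc =
    ¬C5 (a , b , c , ab , bc , ac , da , inj₂ db , inj₂ dc)

  -- A split of u away from its neighbour v: three further distinct neighbours of u,
  -- a non-adjacent pair a, b and a third one c.  Two splits at the ends of an edge
  -- of degree-4 vertices with different thirds form configuration C4.
  record Split (u v a : V) : Set where
    constructor split
    field
      b c  : V
      nbrs : Nbrs u (c ∷ b ∷ a ∷ v ∷ [])
      a≁b  : ¬ A a b

  b≢c : ∀ {u v a} (X : Split u v a) → Split.b X ≢ Split.c X
  b≢c (split _ _ (((c≢b ∷ _) ∷ _) , _) _) = ≢-sym c≢b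

  flip-pair : ∀ {u v a} (X : Split u v a) → Split u v (Split.b X)
  flip-pair {a = a} (split b c N a≁b) = split a c (reorder (↭.prep c (↭.swap b a ↭.refl)) N) (a≁b ∘ adj-sym)

  resplit : ∀ {u v a} (X : Split u v a) → ¬ A a (Split.c X) → Split u v a
  resplit (split b c N _) a≁c = split c b (reorder (↭.swap c b ↭.refl) N) a≁c

  module _ (¬C4 : ¬ C4 G) {u v : V} (uv : A u v) (du : d u ≡ 4) (dv : d v ≡ 4) where

    thirds-agree : ∀ {a a′} (X : Split u v a) (Y : Split v u a′) → Split.c X ≡ Split.c Y
    thirds-agree {a} {a′}
      (split b c ((c≢b ∷ c≢a ∷ c≢v ∷ []) ∷ (b≢a ∷ b≢v ∷ []) ∷ (a≢v ∷ []) ∷ [] ∷ [] , uc ∷ ub ∷ ua ∷ _) a≁b)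
      (split b′ c′ ((c′≢b′ ∷ c′≢a′ ∷ c′≢u ∷ []) ∷ (b′≢a′ ∷ b′≢u ∷ []) ∷ (a′≢u ∷ []) ∷ [] ∷ [] , vc′ ∷ vb′ ∷ va′ ∷ _) a′≁b′) =
      decidable-stable (c ≟ c′) λ c≢c′ →
        ¬C4 (u , v , uv , du , dv , a , b , c , a′ , b′ , c′ ,
             (ua , ub , uc) , (a≢v , b≢v , c≢v) , (≢-sym b≢a , ≢-sym c≢a , ≢-sym c≢b) ,
             (va′ , vb′ , vc′) , (a′≢u , b′≢u , c′≢u) , (≢-sym b′≢a′ , ≢-sym c′≢a′ , ≢-sym c′≢b′) ,
             a≁b , a′≁b′ , c≢c′)

    -- Consequently the third is adjacent to both members of the pair: otherwise
    -- re-splitting would produce a split with a different third.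
    third-sees-pair : ∀ {a a′} (X : Split u v a) (Y : Split v u a′) →
      A (Split.c X) a × A (Split.c X) (Split.b X)
    third-sees-pair X Y = third-sees-first X , third-sees-first (flip-pair X)
      where
      third-sees-first : ∀ {a} (X : Split u v a) → A (Split.c X) a
      third-sees-first {a} X = decidable-stable (adj? (Split.c X) a) λ c≁a →
        b≢c X (trans (thirds-agree (resplit X (c≁a ∘ adj-sym)) Y) (sym (thirds-agree X Y)))

  -- In a C3-free graph, if u, x are adjacent degree-4 vertices and x is not adjacent
  -- to u's neighbour v, then x lies in a split of u away from v: otherwise x sees
  -- both remaining neighbours of u, which are then the only common neighbours of u, x.
  split-at : ¬ C3 G → ∀ {u v x} → d u ≡ 4 → d x ≡ 4 → A u v → A u x → x ≢ v → ¬ A x v → Split u v x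
  split-at ¬C3 {u} {v} {x} du dx uv ux x≢v x≁v with remaining-nbrs du ux uv x≢v
  ... | t₁ , t₂ , N with adj? x t₁ | adj? x t₂
  ...   | no x≁t₁ | _ = split t₁ t₂ N x≁t₁
  ...   | yes _ | no x≁t₂ = split t₂ t₁ (reorder (↭.swap t₂ t₁ ↭.refl) N) x≁t₂
  ...   | yes xt₁ | yes xt₂ = ⊥-elim (¬C3 (u , x , ux , du , dx ,
            two-common-nbrs du (reorder (↭.prep t₂ (↭.prep t₁ (↭.swap x v ↭.refl))) N) xt₂ xt₁ x≁v))

  -- Splits of u and v around a path x u v y with a common third t: if the pairs share
  -- their second member, u and v have exactly two common neighbours (C3); otherwise t
  -- is adjacent to the six distinct vertices u, v, x, y, b, b′.
  common-third-clash : MaxDegAtMost G 5 → ¬ C3 G → ∀ {u v x y b b′ t t′} →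
    A u v → d u ≡ 4 → d v ≡ 4 → ¬ A x v → ¬ A u y → x ≢ y →
    Nbrs u (t ∷ b ∷ x ∷ v ∷ []) → Nbrs v (t′ ∷ b′ ∷ y ∷ u ∷ []) → t ≡ t′ →
    A t x × A t b → A t′ y × A t′ b′ → ⊥
  common-third-clash Δ≤5 ¬C3 {u} {v} {x} {y} {b} {b′} {t} uv du dv x≁v u≁y x≢y
    Nu@((_ ∷ _ ∷ _ ∷ []) ∷ (b≢x ∷ b≢v ∷ []) ∷ (x≢v ∷ []) ∷ [] ∷ [] , ut ∷ ub ∷ ux ∷ _ ∷ [])
    ((_ ∷ _ ∷ _ ∷ []) ∷ (b′≢y ∷ b′≢u ∷ []) ∷ (y≢u ∷ []) ∷ [] ∷ [] , vt ∷ vb′ ∷ vy ∷ _ ∷ [])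
    refl (tx , tb) (ty , tb′) with b ≟ b′
  ... | yes refl = ¬C3 (u , v , uv , du , dv , two-common-nbrs du Nu vt vb′ (x≁v ∘ adj-sym))
  ... | no b≢b′ = too-many-nbrs {t}
        ((adj⇒≢ uv ∷ adj⇒≢ ux ∷ ≢-sym y≢u ∷ adj⇒≢ ub ∷ ≢-sym b′≢u ∷ []) ∷
         (≢-sym x≢v ∷ adj⇒≢ vy ∷ ≢-sym b≢v ∷ adj⇒≢ vb′ ∷ []) ∷
         (x≢y ∷ ≢-sym b≢x ∷ (λ x≡b′ → x≁v (adj-sym (subst (A v) (sym x≡b′) vb′))) ∷ []) ∷
         ((λ y≡b → u≁y (subst (A u) (sym y≡b) ub)) ∷ ≢-sym b′≢y ∷ []) ∷
         (b≢b′ ∷ []) ∷ [] ∷ [] ,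
         adj-sym ut ∷ adj-sym vt ∷ tx ∷ ty ∷ tb ∷ tb′ ∷ [])
        (s≤s (Δ≤5 t))

  no-degree-4-path : MaxDegAtMost G 5 → ¬ C3 G → ¬ C4 G → ¬ C5 G → ∀ {x u v y} →
    A x u → A u v → A v y → x ≢ v → u ≢ y → x ≢ y →
    d x ≡ 4 → d u ≡ 4 → d v ≡ 4 → d y ≡ 4 → ⊥
  no-degree-4-path Δ≤5 ¬C3 ¬C4 ¬C5 {x} {u} {v} {y} xu uv vy x≢v u≢y x≢y dx du dv dy =
    common-third-clash Δ≤5 ¬C3 uv du dv x≁v u≁y x≢y (Split.nbrs X) (Split.nbrs Y)
      (thirds-agree ¬C4 uv du dv X Y)
      (third-sees-pair ¬C4 uv du dv X Y) (third-sees-pair ¬C4 (adj-sym uv) dv du Y X)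
    where
    x≁v : ¬ A x v
    x≁v xv = no-degree-4-triangle ¬C5 xu uv xv dx du dv

    u≁y : ¬ A u y
    u≁y uy = no-degree-4-triangle ¬C5 uv vy uy du dv dy

    X : Split u v x
    X = split-at ¬C3 du dx uv (adj-sym xu) x≢v x≁v

    Y : Split v u y
    Y = split-at ¬C3 dv dy (adj-sym uv) vy (≢-sym u≢y) (u≁y ∘ adj-sym)

  -- A cycle c 0 … c m of even-degree vertices: all its vertices have degree 4, so
  -- it is a degree-4 triangle (m = 2) or contains a degree-4 path c 0 c 1 c 2 c 3.
  no-even-cycle : Connected G → ¬ (G ≅ K 3) → MaxDegAtMost G 5 →
    ¬ C1 G → ¬ C3 G → ¬ C4 G → ¬ C5 G → ¬ CycleIn G ev
  no-even-cycle conn ¬K3 Δ≤5 ¬C1 ¬C3 ¬C4 ¬C5 cycle = on-length m≥2 c-inj c-in c-step c-close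
    where
    open CycleIn cycle using (m≥2; c-inj; c-in; c-step; c-close)

    degree-4 : ∀ {p q s} → ev p → ev q → ev s → A p q → A q s → p ≢ s → d q ≡ 4
    degree-4 = middle-degree-4 conn ¬K3 Δ≤5 ¬C1 ¬C5

    apart : ∀ {k} {c : Fin k → V} → Injective _≡_ _≡_ c → ∀ i j → i ≢ j → c i ≢ c j
    apart inj _ _ i≢j = i≢j ∘ inj

    on-length : ∀ {k} {c : Fin (suc k) → V} → 2 ≤ k → Injective _≡_ _≡_ c → (∀ i → ev (c i)) →
      (∀ (i : Fin k) → A (c (inject₁ i)) (c (suc i))) → A (c (fromℕ k)) (c zero) → ⊥
    on-length {1} (s≤s ()) _ _ _ _
    on-length {2} _ inj even step close =
      no-degree-4-triangle ¬C5 (step 0F) (step 1F) (adj-sym close)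
        (degree-4 (even 2F) (even 0F) (even 1F) close (step 0F) (apart inj 2F 1F λ ()))
        (degree-4 (even 0F) (even 1F) (even 2F) (step 0F) (step 1F) (apart inj 0F 2F λ ()))
        (degree-4 (even 1F) (even 2F) (even 0F) (step 1F) close (apart inj 1F 0F λ ()))
    on-length {suc (suc (suc k))} _ inj even step close =
      no-degree-4-path Δ≤5 ¬C3 ¬C4 ¬C5 (step 0F) (step 1F) (step 2F)
        (apart inj 0F 2F λ ()) (apart inj 1F 3F λ ()) (apart inj 0F 3F λ ())
        (degree-4 (even (fromℕ (3 + k))) (even 0F) (even 1F) close (step 0F) (apart inj (fromℕ (3 + k)) 1F λ ()))
        (degree-4 (even 0F) (even 1F) (even 2F) (step 0F) (step 1F) (apart inj 0F 2F λ ()))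
        (degree-4 (even 1F) (even 2F) (even 3F) (step 1F) (step 2F) (apart inj 1F 3F λ ()))
        (degree-of-c₃ k inj even step close)
      where
      -- c 3 is followed on the cycle by c 0 (length 4) or by c 4 (longer cycles)
      degree-of-c₃ : ∀ k {c : Fin (4 + k) → V} → Injective _≡_ _≡_ c → (∀ i → ev (c i)) →
        (∀ (i : Fin (3 + k)) → A (c (inject₁ i)) (c (suc i))) → A (c (fromℕ (3 + k))) (c zero) →
        d (c 3F) ≡ 4
      degree-of-c₃ zero inj even step close =
        degree-4 (even 2F) (even 3F) (even 0F) (step 2F) close (apart inj 2F 0F λ ())
      degree-of-c₃ (suc _) inj even step close =
        degree-4 (even 2F) (even 3F) (even 4F) (step 2F) (step 3F) (apart inj 2F 4F λ ())

lemma2 : ∀ (n : ℕ) (G : Graph n) →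
    Connected G → ¬ (G ≅ K 3) → ¬ (G ≅ K 5) → MaxDegAtMost G 5 →
    ¬ C1 G → ¬ C2 G → ¬ C3 G → ¬ C4 G → ¬ C5 G →
    EvenSubgraphIsForest G
lemma2 n G conn ¬K3 _ Δ≤5 ¬C1 _ ¬C3 ¬C4 ¬C5 =
  GraphFacts.no-even-cycle G conn ¬K3 Δ≤5 ¬C1 ¬C3 ¬C4 ¬C5
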